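{- Let $\emptyset\vdash t:\sigma$ be derivable in system $\mathcal B$, where $\sigma$ is not of the form $\mathcal M\to\rho$. If $t$ is a surface normal form, then $t=\,!u$ for some term $u$.
   Context: Terms: $t ::= x \mid t\,u \mid \lambda x.t \mid\ !t \mid \mathrm{der}(t) \mid t[x\backslash u]$ (usual binders, $\alpha$, capture-avoiding substitution $t\{x:=u\}$). List contexts $L ::= \langle\cdot\rangle \mid L[x\backslash t]$; surface contexts $S ::= \langle\cdot\rangle \mid S t \mid t S \mid \lambda x.S \mid \mathrm{der}(S) \mid S[x\backslash t] \mid t[x\backslash S]$. Rules (capture-free): $L\langle\lambda x.t\rangle u\mapsto L\langle t[x\backslash u]\rangle$; $t[x\backslash L\langle !u\rangle]\mapsto L\langle t\{x:=u\}\rangle$; $\mathrm{der}(L\langle !t\rangle)\mapsto L\langle t\rangle$; surface reduction is their closure under surface contexts, and a surface normal form is a term with no surface reduct. Types $\sigma ::= \alpha \mid \mathcal M \mid \mathcal M\to\sigma$, multitypes finite multisets of types; environments map variables to multitypes (finitely many non-empty), $+$ pointwise union, $\emptyset$ everywhere empty. System $\mathcal B$: (var) $x:[\sigma]\vdash x:\sigma$; (abs) $\Gamma,x:\mathcal M\vdash t:\sigma\Rightarrow\Gamma\vdash\lambda x.t:\mathcal M\to\sigma$; (app) $\Gamma\vdash t:\mathcal M\to\sigma$, $\Delta\vdash u:\mathcal M\Rightarrow\Gamma+\Delta\vdash tu:\sigma$; (es) $\Gamma,x:\mathcal M\vdash t:\sigma$, $\Delta\vdash u:\mathcal M\Rightarrow\Gamma+\Delta\vdash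 t[x\backslash u]:\sigma$; (bg) $(\Gamma_i\vdash t:\sigma_i)_{i\in I}$ ($I$ finite, possibly empty) $\Rightarrow+_i\Gamma_i\vdash !t:[\sigma_i]_{i\in I}$; (dr) $\Gamma\vdash t:[\sigma]\Rightarrow\Gamma\vdash\mathrm{der}(t):\sigma$. -}

module Defs where

open import Data.Nat using (ℕ; zero; suc)
open import Data.Fin using (Fin; zero; suc)
open import Data.List using (List; []; _∷_; _++_; [_])
open import Data.Vec using (Vec; []; _∷_; zipWith; replicate; lookup; _[_]≔_)
open import Data.Empty using (⊥)
open import Data.Unit using (⊤)
open import Relation.Nullary using (¬_)

-- Terms, intrinsically scoped (de Bruijn indices, so α-equivalent terms
-- are literally equal).  In  es t u  (= t[x\u]) and  lam t , the bound variable is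
-- index zero of t.

data Term (n : ℕ) : Set where
  var  : Fin n → Term n
  app  : Term n → Term n → Term n
  lam  : Term (suc n) → Term n
  bang : Term n → Term n
  der  : Term n → Term n
  es   : Term (suc n) → Term n → Term n

ext : ∀ {n m} → (Fin n → Fin m) → Fin (suc n) → Fin (suc m)
ext ρ zero    = zero
ext ρ (suc i) = suc (ρ i)

rename : ∀ {n m} → (Fin n → Fin m) → Term n → Term m
rename ρ (var x)   = var (ρ x)
rename ρ (app t u) = app (rename ρ t) (rename ρ u)
rename ρ (lam t)   = lam (rename (ext ρ) t)
rename ρ (bang t)  = bang (rename ρ t)
rename ρ (der t)   = der (rename ρ t)
rename ρ (es t u)  = es (rename (ext ρ) t) (rename ρ u)

exts : ∀ {n m} → (Fin n → Term m) → Fin (suc n) → Term (suc m)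
exts σ zero    = var zero
exts σ (suc i) = rename suc (σ i)

subst : ∀ {n m} → (Fin n → Term m) → Term n → Term m
subst σ (var x)   = σ x
subst σ (app t u) = app (subst σ t) (subst σ u)
subst σ (lam t)   = lam (subst (exts σ) t)
subst σ (bang t)  = bang (subst σ t)
subst σ (der t)   = der (subst σ t)
subst σ (es t u)  = es (subst (exts σ) t) (subst σ u)

subst0-σ : ∀ {n} → Term n → Fin (suc n) → Term n
subst0-σ u zero    = u
subst0-σ u (suc i) = var i

_[0:=_] : ∀ {n} → Term (suc n) → Term n → Term n
t [0:= u ] = subst (subst0-σ u) t

-- List contexts  L ::= ⟨·⟩ | L[x\t]
-- LCtx n m : a list context whose outside lives in scope n and whose
-- hole lives in scope m (m = n + number of substitutions in L).

data LCtx : ℕ → ℕ → Set where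
  hole : ∀ {n} → LCtx n n
  _[_] : ∀ {n m} → LCtx (suc n) m → Term n → LCtx n m

plug : ∀ {n m} → LCtx n m → Term m → Term n
plug hole       s = s
plug (L [ t ])  s = es (plug L s) t

-- the inclusion of the outer scope of L into its hole scope
-- (used to weaken terms moved under L's binders: capture-freeness)
weakL : ∀ {n m} → LCtx n m → Fin n → Fin m
weakL hole      i = i
weakL (L [ t ]) i = weakL L (suc i)

data _↦_ {n : ℕ} : Term n → Term n → Set where
  -- L⟨λx.t⟩ u ↦ L⟨t[x\u]⟩
  dB : ∀ {m} (L : LCtx n m) (t : Term (suc m)) (u : Term n) →
       app (plug L (lam t)) u ↦ plug L (es t (rename (weakL L) u))
  -- t[x\L⟨!u⟩] ↦ L⟨t{x:=u}⟩
  s! : ∀ {m} (L : LCtx n m) (t : Term (suc n)) (u : Term m) →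
       es t (plug L (bang u)) ↦ plug L ((rename (ext (weakL L)) t) [0:= u ])
  -- der(L⟨!t⟩) ↦ L⟨t⟩
  d! : ∀ {m} (L : LCtx n m) (t : Term m) →
       der (plug L (bang t)) ↦ plug L t

data _⟶s_ : ∀ {n} → Term n → Term n → Set where
  root  : ∀ {n} {t t' : Term n} → t ↦ t' → t ⟶s t'
  appL  : ∀ {n} {t t' u : Term n} → t ⟶s t' → app t u ⟶s app t' u
  appR  : ∀ {n} {t u u' : Term n} → u ⟶s u' → app t u ⟶s app t u'
  lamS  : ∀ {n} {t t' : Term (suc n)} → t ⟶s t' → lam t ⟶s lam t'
  derS  : ∀ {n} {t t' : Term n} → t ⟶s t' → der t ⟶s der t'
  esL   : ∀ {n} {t t' : Term (suc n)} {u : Term n} → t ⟶s t' → es t u ⟶s es t' u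
  esR   : ∀ {n} {t : Term (suc n)} {u u' : Term n} → u ⟶s u' → es t u ⟶s es t u'

SurfaceNormal : ∀ {n} → Term n → Set
SurfaceNormal t = ∀ t' → ¬ (t ⟶s t')

-- Types  σ ::= α | M | M → σ ; multitypes are finite multisets of types,
-- represented by lists taken up to permutation (see _≈T_/_≈M_ below).

data Ty : Set where
  atom : ℕ → Ty
  mt   : List Ty → Ty
  _⇒_  : List Ty → Ty → Ty

MT : Set
MT = List Ty

-- equality of types/multitypes: the congruence generated by permuting
-- multiset elements (i.e. equality of the represented multisets)
data _≈T_ : Ty → Ty → Set
data _≈M_ : MT → MT → Set

data _≈T_ where
  atom : ∀ a → atom a ≈T atom a
  mt   : ∀ {M M'} → M ≈M M' → mt M ≈T mt M'
  _⇒_  : ∀ {M M' σ σ'} → M ≈M M' → σ ≈T σ' → (M ⇒ σ) ≈T (M' ⇒ σ')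

data _≈M_ where
  []    : [] ≈M []
  _∷_   : ∀ {σ σ' M M'} → σ ≈T σ' → M ≈M M' → (σ ∷ M) ≈M (σ' ∷ M')
  swap  : ∀ σ τ M → (σ ∷ τ ∷ M) ≈M (τ ∷ σ ∷ M)
  trans : ∀ {M M' M''} → M ≈M M' → M' ≈M M'' → M ≈M M''

-- environments over the scope n (all variables outside the scope are
-- mapped to the empty multitype)
Env : ℕ → Set
Env n = Vec MT n

∅ : ∀ {n} → Env n
∅ = replicate _ []

_+E_ : ∀ {n} → Env n → Env n → Env n
_+E_ = zipWith _++_

single : ∀ {n} → Fin n → Ty → Env n
single x σ = ∅ [ x ]≔ [ σ ]

data _≈E_ : ∀ {n} → Env n → Env n → Set where
  []  : [] ≈E []
  _∷_ : ∀ {n M M'} {Γ Γ' : Env n} → M ≈M M' → Γ ≈E Γ' → (M ∷ Γ) ≈E (M' ∷ Γ')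

-- System B.  Γ , x : M  is  M ∷ Γ  (x = variable zero).
-- ⊢! is the family premise of (bg): (Γᵢ ⊢ t : σᵢ)_{i∈I} gives +ᵢΓᵢ ⊢! t : [σᵢ]ᵢ.
-- conv makes derivability invariant under multiset equality.

data _⊢_∶_ : ∀ {n} → Env n → Term n → Ty → Set
data _⊢!_∶_ : ∀ {n} → Env n → Term n → MT → Set

data _⊢_∶_ where
  var  : ∀ {n} (x : Fin n) (σ : Ty) → single x σ ⊢ var x ∶ σ
  abs  : ∀ {n} {Γ : Env n} {M σ t} → (M ∷ Γ) ⊢ t ∶ σ → Γ ⊢ lam t ∶ (M ⇒ σ)
  app  : ∀ {n} {Γ Δ : Env n} {M σ t u} →
         Γ ⊢ t ∶ (M ⇒ σ) → Δ ⊢ u ∶ mt M → (Γ +E Δ) ⊢ app t u ∶ σ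
  es   : ∀ {n} {Γ Δ : Env n} {M σ t u} →
         (M ∷ Γ) ⊢ t ∶ σ → Δ ⊢ u ∶ mt M → (Γ +E Δ) ⊢ es t u ∶ σ
  bg   : ∀ {n} {Γ : Env n} {M t} → Γ ⊢! t ∶ M → Γ ⊢ bang t ∶ mt M
  dr   : ∀ {n} {Γ : Env n} {σ t} → Γ ⊢ t ∶ mt [ σ ] → Γ ⊢ der t ∶ σ
  conv : ∀ {n} {Γ Γ' : Env n} {σ σ' t} →
         Γ ⊢ t ∶ σ → Γ ≈E Γ' → σ ≈T σ' → Γ' ⊢ t ∶ σ'

data _⊢!_∶_ where
  []  : ∀ {n} {t : Term n} → ∅ ⊢! t ∶ []
  _∷_ : ∀ {n} {Γ Δ : Env n} {σ M t} →
        Γ ⊢ t ∶ σ → Δ ⊢! t ∶ M → (Γ +E Δ) ⊢! t ∶ (σ ∷ M)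

IsArrow : Ty → Set
IsArrow (M ⇒ ρ) = ⊤
IsArrow _       = ⊥

-- No variable can be typed in an empty environment, and the premises of
-- app (function), es (substituted term) and dr are typed in empty
-- environments too. So by induction a surface normal form typed in an empty
-- environment is an abstraction of arrow type or a bang of multitype:
-- otherwise the type of the relevant premise forces it to be an abstraction
-- applied to an argument, or a bang under es or der, i.e. a root redex.
module Submission where

open import Defs
open import Data.Nat using (ℕ; suc)
open import Data.Fin using (Fin; zero; suc)
open import Data.List using ([]; _∷_; length)
open import Data.List.Properties using (++-conicalˡ; ++-conicalʳ)
open import Data.Vec using (lookup)
open import Data.Vec.Properties using (lookup-replicate; lookup-zipWith; lookup∘update)
open import Data.Product using (∃-syntax; _,_)
open import Data.Empty using (⊥-elim)
open import Function using (_∘_)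
open import Relation.Nullary using (¬_)
open import Relation.Binary.PropositionalEquality using (_≡_; refl; sym; cong)
  renaming (trans to ≡-trans)

EmptyEnv : ∀ {n} → Env n → Set
EmptyEnv Γ = ∀ x → lookup Γ x ≡ []

∅-empty : ∀ {n} → EmptyEnv (∅ {n})
∅-empty x = lookup-replicate x []

+E-emptyˡ : ∀ {n} (Γ Δ : Env n) → EmptyEnv (Γ +E Δ) → EmptyEnv Γ
+E-emptyˡ Γ Δ e x = ++-conicalˡ _ _ (≡-trans (sym (lookup-zipWith _ x Γ Δ)) (e x))

+E-emptyʳ : ∀ {n} (Γ Δ : Env n) → EmptyEnv (Γ +E Δ) → EmptyEnv Δ
+E-emptyʳ Γ Δ e x = ++-conicalʳ _ _ (≡-trans (sym (lookup-zipWith _ x Γ Δ)) (e x))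

single-nonempty : ∀ {n} (x : Fin n) σ → ¬ EmptyEnv (single x σ)
single-nonempty x σ e with ≡-trans (sym (lookup∘update x ∅ (σ ∷ []))) (e x)
... | ()

≈M-length : ∀ {M M'} → M ≈M M' → length M ≡ length M'
≈M-length []           = refl
≈M-length (_ ∷ p)      = cong suc (≈M-length p)
≈M-length (swap _ _ _) = refl
≈M-length (trans p q)  = ≡-trans (≈M-length p) (≈M-length q)

≈M-[] : ∀ {M M'} → M ≈M M' → M' ≡ [] → M ≡ []
≈M-[] {[]}    _ _    = refl
≈M-[] {_ ∷ _} p refl with ≈M-length p
... | ()

≈E-empty : ∀ {n} {Γ Γ' : Env n} → Γ ≈E Γ' → EmptyEnv Γ' → EmptyEnv Γ
≈E-empty (p ∷ _) e zero    = ≈M-[] p (e zero)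
≈E-empty (_ ∷ q) e (suc x) = ≈E-empty q (e ∘ suc) x

data Canonical {n} : Term n → Ty → Set where
  lam  : ∀ t {M σ} → Canonical (lam t) (M ⇒ σ)
  bang : ∀ u {M} → Canonical (bang u) (mt M)

Canonical-≈T : ∀ {n} {t : Term n} {σ σ'} → Canonical t σ → σ ≈T σ' → Canonical t σ'
Canonical-≈T (lam t)  (_ ⇒ _) = lam t
Canonical-≈T (bang u) (mt _)  = bang u

surface-normal-canonical : ∀ {n} {Γ : Env n} {t σ} →
  EmptyEnv Γ → Γ ⊢ t ∶ σ → SurfaceNormal t → Canonical t σ
surface-normal-canonical e (var x σ) nf = ⊥-elim (single-nonempty x σ e)
surface-normal-canonical e (abs {t = t} _) nf = lam t
surface-normal-canonical e (bg {t = u} _) nf = bang u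
surface-normal-canonical e (app {Γ = Γ} {Δ} {u = u} d _) nf
  with surface-normal-canonical (+E-emptyˡ Γ Δ e) d (λ _ → nf _ ∘ appL)
... | lam t = ⊥-elim (nf _ (root (dB hole t u)))
surface-normal-canonical e (es {Γ = Γ} {Δ} {t = t} _ d) nf
  with surface-normal-canonical (+E-emptyʳ Γ Δ e) d (λ _ → nf _ ∘ esR)
... | bang u = ⊥-elim (nf _ (root (s! hole t u)))
surface-normal-canonical e (dr d) nf
  with surface-normal-canonical e d (λ _ → nf _ ∘ derS)
... | bang u = ⊥-elim (nf _ (root (d! hole u)))
surface-normal-canonical e (conv d p q) nf =
  Canonical-≈T (surface-normal-canonical (≈E-empty p e) d nf) q

lemmaB3 : ∀ {n : ℕ} (t : Term n) (σ : Ty) →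
    ∅ ⊢ t ∶ σ → ¬ IsArrow σ → SurfaceNormal t →
    ∃[ u ] t ≡ bang u
lemmaB3 t σ d σ-not-arrow nf with surface-normal-canonical ∅-empty d nf
... | lam _  = ⊥-elim (σ-not-arrow _)
... | bang u = u , refl
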